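{- Let $\mathcal{F}=(W,R,S)$ be any simplified $\mathbf{IL}^-(\mathbf{J4}_+)$-frame. Then: (1) $\mathcal{F}\models (A\rhd C)\land(B\rhd C)\to(A\lor B)\rhd C$ for all formulas $A,B,C$ (axiom $\mathbf{J3}$); (2) $\mathcal{F}\models \Box(A\to B)\to(C\rhd A\to C\rhd B)$ for all $A,B,C$ (axiom $\mathbf{J4}_+$); (3) $\mathcal{F}\models \Box\neg A\leftrightarrow A\rhd\bot$ for all $A$ (axiom $\mathbf{J6}$); (4) every instance of $\mathbf{J1}$: $\Box(A\to B)\to A\rhd B$ is valid in $\mathcal{F}$ if and only if for all $x,y\in W$, $xRy$ implies $ySy$; (5) every instance of $\mathbf{J2}_+$: $A\rhd(B\lor C)\land B\rhd C\to A\rhd C$ is valid in $\mathcal{F}$ if and only if for all $x\in W$ and all $y,z,v\in R[x]:=\{u\in W: xRu\}$, $ySz$ and $zSv$ imply $ySv$; (6) every instance of $\mathbf{J5}$: $\Diamond A\rhd A$ is valid in $\mathcal{F}$ if and only if for all $x,y,z\in W$, $xRy$ and $yRz$ imply $ySz$.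
   Context: Modal formulas are built from propositional variables, $\top,\bot$, connectives $\to,\lor,\land$, the unary modality $\Box$ and the binary modality $\rhd$; $\neg A:=A\to\bot$, $\Diamond A:=\neg\Box\neg A$. A simplified $\mathbf{IL}^-(\mathbf{J4}_+)$-frame is a triple $(W,R,S)$ where $W$ is a non-empty set, $R$ is a transitive and conversely well-founded binary relation on $W$, and $S$ is an arbitrary binary relation on $W$. A model on it is given by a valuation of propositional variables, with forcing defined as usual for Boolean connectives, $x\Vdash\Box A$ iff $y\Vdash A$ for all $y$ with $xRy$, and $x\Vdash A\rhd B$ iff for every $y$ with $xRy$ and $y\Vdash A$ there is $z\in W$ with $xRz$, $ySz$ and $z\Vdash B$. A formula is valid in a frame ($\mathcal{F}\models A$) if it is forced at every point of every model on that frame. -}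

module Defs where

open import Data.Nat using (ℕ)
open import Data.Empty using (⊥)
open import Data.Unit using (⊤)
open import Data.Product using (Σ; _×_; ∃-syntax)
open import Data.Sum using (_⊎_)
open import Function using (flip)
open import Induction.WellFounded using (WellFounded)

infixr 6 _∧'_
infixr 5 _∨'_
infixr 4 _⇒_
infix 7 □_
infix 6 _▷_

data Fm : Set where
  var  : ℕ → Fm
  ⊤'   : Fm
  ⊥'   : Fm
  _⇒_  : Fm → Fm → Fm
  _∨'_ : Fm → Fm → Fm
  _∧'_ : Fm → Fm → Fm
  □_   : Fm → Fm
  _▷_  : Fm → Fm → Fm

¬'_ : Fm → Fm
¬' A = A ⇒ ⊥'

◇_ : Fm → Fm
◇ A = ¬' (□ (¬' A))

_⇔'_ : Fm → Fm → Fm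
A ⇔' B = (A ⇒ B) ∧' (B ⇒ A)

-- Simplified IL⁻(J4₊)-frame: R transitive and conversely well-founded,
-- S arbitrary.  Conversely well-founded: flip R is well-founded
-- (no infinite ascending R-chains).
record Frame : Set₁ where
  field
    W     : Set
    R     : W → W → Set
    S     : W → W → Set
    inhabited : W
    R-trans : ∀ {x y z} → R x y → R y z → R x z
    R-cwf   : WellFounded (flip R)

module _ (F : Frame) where
  open Frame F

  Valuation : Set₁
  Valuation = ℕ → W → Set

  Forces : Valuation → W → Fm → Set
  Forces V x (var p)  = V p x
  Forces V x ⊤'       = ⊤
  Forces V x ⊥'       = ⊥
  Forces V x (A ⇒ B)  = Forces V x A → Forces V x B
  Forces V x (A ∨' B) = Forces V x A ⊎ Forces V x B
  Forces V x (A ∧' B) = Forces V x A × Forces V x B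
  Forces V x (□ A)    = ∀ y → R x y → Forces V y A
  Forces V x (A ▷ B)  = ∀ y → R x y → Forces V y A →
                          ∃[ z ] (R x z × S y z × Forces V z B)

  Valid : Fm → Set₁
  Valid A = ∀ (V : Valuation) (x : W) → Forces V x A

-- J3, J4₊ and J6 hold on every frame by unfolding the forcing clauses. For
-- J1, J2₊ and J5 the frame conditions are sufficient by the same unfolding,
-- and necessary by instantiating the axiom under a valuation making each
-- variable true at exactly one point: the S-successor that ▷ then provides
-- is forced to be the intended point. Only the sufficiency of the J5
-- condition is classical, since it turns ◇A into an R-successor forcing A.
module Submission where

open import Defs
open import Data.Nat using (ℕ)
open import Data.Product using (_×_; _,_; proj₂; ∃-syntax)
open import Data.Sum using (inj₁; inj₂)
open import Data.Empty using (⊥-elim)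
open import Function.Bundles using (_⇔_; mk⇔)
open import Axiom.ExcludedMiddle using (ExcludedMiddle)
open import Level using (0ℓ)
open import Relation.Nullary using (yes; no)
open import Relation.Binary.PropositionalEquality using (_≡_; refl)

J1 : Fm → Fm → Fm
J1 A B = □ (A ⇒ B) ⇒ (A ▷ B)

J2₊ : Fm → Fm → Fm → Fm
J2₊ A B C = (A ▷ (B ∨' C)) ∧' (B ▷ C) ⇒ (A ▷ C)

J3 : Fm → Fm → Fm → Fm
J3 A B C = (A ▷ C) ∧' (B ▷ C) ⇒ ((A ∨' B) ▷ C)

J4₊ : Fm → Fm → Fm → Fm
J4₊ A B C = □ (A ⇒ B) ⇒ ((C ▷ A) ⇒ (C ▷ B))

J5 : Fm → Fm
J5 A = (◇ A) ▷ A

J6 : Fm → Fm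
J6 A = (□ (¬' A)) ⇔' (A ▷ ⊥')

module _ (F : Frame) where
  open Frame F

  S-reflexiveOnRImage : Set
  S-reflexiveOnRImage = ∀ x y → R x y → S y y

  S-transitiveOnRSuccessors : Set
  S-transitiveOnRSuccessors =
    ∀ x y z v → R x y → R x z → R x v → S y z → S z v → S y v

  R⊆SOnRImage : Set
  R⊆SOnRImage = ∀ x y z → R x y → R y z → S y z

  pointValuation : (ℕ → W) → Valuation F
  pointValuation point p w = w ≡ point p

  J3-valid : ∀ A B C → Valid F (J3 A B C)
  J3-valid A B C V x (A▷C , B▷C) y xRy (inj₁ y⊩A) = A▷C y xRy y⊩A
  J3-valid A B C V x (A▷C , B▷C) y xRy (inj₂ y⊩B) = B▷C y xRy y⊩B

  J4₊-valid : ∀ A B C → Valid F (J4₊ A B C)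
  J4₊-valid A B C V x □A⇒B C▷A y xRy y⊩C with C▷A y xRy y⊩C
  ... | z , xRz , ySz , z⊩A = z , xRz , ySz , □A⇒B z xRz z⊩A

  J6-valid : ∀ A → Valid F (J6 A)
  J6-valid A V x = □¬A⇒A▷⊥ , A▷⊥⇒□¬A
    where
    □¬A⇒A▷⊥ : Forces F V x (□ (¬' A) ⇒ (A ▷ ⊥'))
    □¬A⇒A▷⊥ □¬A y xRy y⊩A = ⊥-elim (□¬A y xRy y⊩A)
    A▷⊥⇒□¬A : Forces F V x ((A ▷ ⊥') ⇒ □ (¬' A))
    A▷⊥⇒□¬A A▷⊥ y xRy y⊩A = proj₂ (proj₂ (proj₂ (A▷⊥ y xRy y⊩A)))

  ◇-witness : ExcludedMiddle 0ℓ → ∀ V y A → Forces F V y (◇ A) →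
              ∃[ w ] (R y w × Forces F V w A)
  ◇-witness lem V y A y⊩◇A with lem {∃[ w ] (R y w × Forces F V w A)}
  ... | yes witness = witness
  ... | no none     = ⊥-elim (y⊩◇A λ w yRw w⊩A → none (w , yRw , w⊩A))

  J1-valid⇔S-reflexiveOnRImage :
    (∀ A B → Valid F (J1 A B)) ⇔ S-reflexiveOnRImage
  J1-valid⇔S-reflexiveOnRImage = mk⇔ necessary sufficient
    where
    necessary : (∀ A B → Valid F (J1 A B)) → S-reflexiveOnRImage
    necessary J1-valid x y xRy
      with J1-valid (var 0) (var 0) (pointValuation λ _ → y) x
             (λ _ _ w≡y → w≡y) y xRy refl
    ... | .y , _ , ySy , refl = ySy
    sufficient : S-reflexiveOnRImage → ∀ A B → Valid F (J1 A B)
    sufficient S-refl A B V x □A⇒B y xRy y⊩A =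
      y , xRy , S-refl x y xRy , □A⇒B y xRy y⊩A

  J2₊-valid⇔S-transitiveOnRSuccessors :
    (∀ A B C → Valid F (J2₊ A B C)) ⇔ S-transitiveOnRSuccessors
  J2₊-valid⇔S-transitiveOnRSuccessors = mk⇔ necessary sufficient
    where
    necessary : (∀ A B C → Valid F (J2₊ A B C)) → S-transitiveOnRSuccessors
    necessary J2₊-valid x y z v xRy xRz xRv ySz zSv
      with J2₊-valid (var 0) (var 1) (var 2) V x (p₀▷p₁∨p₂ , p₁▷p₂) y xRy refl
      where
      point : ℕ → W
      point 0 = y
      point 1 = z
      point _ = v
      V : Valuation F
      V = pointValuation point
      p₀▷p₁∨p₂ : Forces F V x (var 0 ▷ (var 1 ∨' var 2))
      p₀▷p₁∨p₂ .y _ refl = z , xRz , ySz , inj₁ refl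
      p₁▷p₂ : Forces F V x (var 1 ▷ var 2)
      p₁▷p₂ .z _ refl = v , xRv , zSv , refl
    ... | .v , _ , ySv , refl = ySv
    sufficient : S-transitiveOnRSuccessors → ∀ A B C → Valid F (J2₊ A B C)
    sufficient S-trans A B C V x (A▷B∨C , B▷C) y xRy y⊩A with A▷B∨C y xRy y⊩A
    ... | z , xRz , ySz , inj₂ z⊩C = z , xRz , ySz , z⊩C
    ... | z , xRz , ySz , inj₁ z⊩B with B▷C z xRz z⊩B
    ...   | v , xRv , zSv , v⊩C =
      v , xRv , S-trans x y z v xRy xRz xRv ySz zSv , v⊩C

  J5-valid⇔R⊆SOnRImage : ExcludedMiddle 0ℓ →
    (∀ A → Valid F (J5 A)) ⇔ R⊆SOnRImage
  J5-valid⇔R⊆SOnRImage lem = mk⇔ necessary sufficient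
    where
    necessary : (∀ A → Valid F (J5 A)) → R⊆SOnRImage
    necessary J5-valid x y z xRy yRz
      with J5-valid (var 0) (pointValuation λ _ → z) x y xRy
             (λ □¬p → □¬p z yRz refl)
    ... | .z , _ , ySz , refl = ySz
    sufficient : R⊆SOnRImage → ∀ A → Valid F (J5 A)
    sufficient R⊆S A V x y xRy y⊩◇A with ◇-witness lem V y A y⊩◇A
    ... | w , yRw , w⊩A = w , R-trans xRy yRw , R⊆S x y w xRy yRw , w⊩A

proposition2p13 : ExcludedMiddle 0ℓ → (F : Frame) →
    let open Frame F in
    (∀ A B C → Valid F (((A ▷ C) ∧' (B ▷ C)) ⇒ ((A ∨' B) ▷ C)))
    × (∀ A B C → Valid F ((□ (A ⇒ B)) ⇒ ((C ▷ A) ⇒ (C ▷ B))))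
    × (∀ A → Valid F ((□ (¬' A)) ⇔' (A ▷ ⊥')))
    × ((∀ A B → Valid F ((□ (A ⇒ B)) ⇒ (A ▷ B)))
        ⇔ (∀ x y → R x y → S y y))
    × ((∀ A B C → Valid F (((A ▷ (B ∨' C)) ∧' (B ▷ C)) ⇒ (A ▷ C)))
        ⇔ (∀ x y z v → R x y → R x z → R x v → S y z → S z v → S y v))
    × ((∀ A → Valid F ((◇ A) ▷ A))
        ⇔ (∀ x y z → R x y → R y z → S y z))
proposition2p13 lem F =
  J3-valid F , J4₊-valid F , J6-valid F ,
  J1-valid⇔S-reflexiveOnRImage F ,
  J2₊-valid⇔S-transitiveOnRSuccessors F ,
  J5-valid⇔R⊆SOnRImage F lem
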